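{- The class $\mathcal{M}_q$ of $GF(q)$-chordal matroids is closed under induced restrictions: if $M\in\mathcal{M}_q$ and $F$ is a flat of $M$, then $M|F\in\mathcal{M}_q$.
   Context: All matroids are simple. $q$ is a prime power. If $M_1,M_2$ are matroids whose ground sets meet in a set $T$ that is a modular flat of $M_1$, with $M_1|T=M_2|T=N$, the generalized parallel connection $P_N(M_1,M_2)$ is the matroid on $E(M_1)\cup E(M_2)$ whose flats are the sets $X$ with $X\cap E(M_1)$ a flat of $M_1$ and $X\cap E(M_2)$ a flat of $M_2$. $\mathcal{M}_q$ is the class of matroids that can be built from projective geometries over $GF(q)$ by a sequence of generalized parallel connections across projective geometries over $GF(q)$. -}

module Defs where

open import Level using (0ℓ)
open import Data.Nat using (ℕ; zero; suc; _+_; _≤_; _<_)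
import Data.Fin as Fin
open import Data.Fin using (Fin)
open import Data.Fin.Subset using (Subset; _∈_; _∉_; _⊆_; _∪_; _∩_; ⁅_⁆; ∣_∣; ⊤)
open import Data.Vec using (tabulate; lookup)
open import Data.Product using (Σ; ∃; _×_)
open import Data.Sum using (_⊎_)
open import Relation.Nullary using (¬_)
open import Relation.Binary.PropositionalEquality using (_≡_; _≢_)
open import Function.Definitions using (Injective)
open import Algebra.Bundles using (CommutativeRing)

-- Finite fields: a field with exactly q elements (so q is a prime power
-- and the field is GF(q), unique up to isomorphism).

record FiniteField (q : ℕ) : Set₁ where
  field
    ring : CommutativeRing 0ℓ 0ℓ
  open CommutativeRing ring public hiding (ring)
  field
    1≉0      : ¬ (1# ≈ 0#)
    inverse  : ∀ x → ¬ (x ≈ 0#) → ∃ λ y → x * y ≈ 1#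
    enum     : Fin q → Carrier
    enum-inj : ∀ i j → enum i ≈ enum j → i ≡ j
    enum-sur : ∀ x → ∃ λ i → enum i ≈ x

record SimpleMatroid (n : ℕ) : Set where
  field
    r        : Subset n → ℕ
    r-bound  : ∀ X → r X ≤ ∣ X ∣
    r-mono   : ∀ {X Y} → X ⊆ Y → r X ≤ r Y
    r-submod : ∀ X Y → r (X ∪ Y) + r (X ∩ Y) ≤ r X + r Y
    simple₁  : ∀ e → r ⁅ e ⁆ ≡ 1
    simple₂  : ∀ e f → e ≢ f → r (⁅ e ⁆ ∪ ⁅ f ⁆) ≡ 2

open SimpleMatroid public

Independent : ∀ {n} → SimpleMatroid n → Subset n → Set
Independent M X = r M X ≡ ∣ X ∣

IsFlat : ∀ {n} → SimpleMatroid n → Subset n → Set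
IsFlat M X = ∀ e → e ∉ X → r M X < r M (X ∪ ⁅ e ⁆)

IsModularFlat : ∀ {n} → SimpleMatroid n → Subset n → Set
IsModularFlat M T =
  IsFlat M T × (∀ X → IsFlat M X → r M (T ∪ X) + r M (T ∩ X) ≡ r M T + r M X)

preimage : ∀ {m n} → (Fin m → Fin n) → Subset n → Subset m
preimage f Y = tabulate (λ i → lookup Y (f i))

module _ {q : ℕ} (F : FiniteField q) where
  open FiniteField F using (Carrier; _≈_; 0#) renaming (_+_ to _⊕_; _*_ to _⊗_)

  sumF : ∀ {n} → (Fin n → Carrier) → Carrier
  sumF {zero}  f = 0#
  sumF {suc n} f = f Fin.zero ⊕ sumF (λ i → f (Fin.suc i))

  LinIndep : ∀ {n k} → (Fin n → Fin k → Carrier) → Subset n → Set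
  LinIndep φ Y = ∀ (c : _ → Carrier) → (∀ e → e ∉ Y → c e ≈ 0#) →
                 (∀ i → sumF (λ e → c e ⊗ φ e i) ≈ 0#) → ∀ e → c e ≈ 0#

  -- M|X is (isomorphic to) the projective geometry PG(k-1,q) for some k ≥ 0:
  -- M|X is represented over GF(q) by φ and every nonzero vector of GF(q)^k
  -- is a scalar multiple of some φ e with e ∈ X.
  IsPGRestriction : ∀ {n} → SimpleMatroid n → Subset n → Set
  IsPGRestriction {n} M X = Σ ℕ λ k → Σ (Fin n → Fin k → Carrier) λ φ →
      (∀ Y → Y ⊆ X → (Independent M Y → LinIndep φ Y) × (LinIndep φ Y → Independent M Y))
    × (∀ (v : Fin k → Carrier) → ¬ (∀ i → v i ≈ 0#) →
         ∃ λ e → e ∈ X × ∃ λ a → ∀ i → v i ≈ a ⊗ φ e i)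

  -- M is (isomorphic to) the generalized parallel connection P_N(M₁,M₂)
  -- across N = M₁|T₁ = M₂|T₂, a projective geometry over GF(q), with T₁ a
  -- modular flat of M₁.  ι₁, ι₂ embed the ground sets of M₁, M₂ into that of M.
  record IsGPC {n n₁ n₂} (M : SimpleMatroid n) (M₁ : SimpleMatroid n₁)
               (M₂ : SimpleMatroid n₂) : Set where
    field
      ι₁     : Fin n₁ → Fin n
      ι₂     : Fin n₂ → Fin n
      ι₁-inj : Injective _≡_ _≡_ ι₁
      ι₂-inj : Injective _≡_ _≡_ ι₂
      cover  : ∀ e → (∃ λ a → ι₁ a ≡ e) ⊎ (∃ λ b → ι₂ b ≡ e)
      T₁     : Subset n₁
      T₂     : Subset n₂
      T₁-def : ∀ a → (a ∈ T₁ → ∃ λ b → ι₂ b ≡ ι₁ a) × ((∃ λ b → ι₂ b ≡ ι₁ a) → a ∈ T₁)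
      T₂-def : ∀ b → (b ∈ T₂ → ∃ λ a → ι₁ a ≡ ι₂ b) × ((∃ λ a → ι₁ a ≡ ι₂ b) → b ∈ T₂)
      T₁-modular : IsModularFlat M₁ T₁
      N-PG   : IsPGRestriction M₁ T₁
      agree  : ∀ X → (∀ {e} → e ∈ X → (∃ λ a → ι₁ a ≡ e) × (∃ λ b → ι₂ b ≡ e)) →
               r M₁ (preimage ι₁ X) ≡ r M₂ (preimage ι₂ X)
      flats  : ∀ X → (IsFlat M X → IsFlat M₁ (preimage ι₁ X) × IsFlat M₂ (preimage ι₂ X))
                   × (IsFlat M₁ (preimage ι₁ X) × IsFlat M₂ (preimage ι₂ X) → IsFlat M X)

  data InClass : ∀ {n} → SimpleMatroid n → Set where
    pg  : ∀ {n} {M : SimpleMatroid n} → IsPGRestriction M ⊤ → InClass M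
    gpc : ∀ {n n₁ n₂} {M : SimpleMatroid n} {M₁ : SimpleMatroid n₁} {M₂ : SimpleMatroid n₂} →
          InClass M₁ → InClass M₂ → IsGPC M M₁ M₂ → InClass M

{-# OPTIONS --safe #-}
-- Restricting to a flat commutes with both constructions that generate 𝓜_q.
-- For a projective geometry represented by φ and a flat Y, pick a basis B of Y: the coordinates
-- of the vectors φ e (e ∈ Y) with respect to φ(B) represent M|Y, and every nonzero coordinate
-- vector occurs: it is a multiple of some φ e, and e ∉ Y would make e spanned by B, contradicting
-- the closedness of Y.  For a generalized parallel connection P_N(M₁,M₂) and a
-- flat Fl, the traces of Fl are flats of M₁ and M₂, and M|Fl is the generalized parallel connection
-- of their restrictions across N|(T ∩ Fl), which is a flat of the projective geometry N (hence a
-- projective geometry) and is modular in M₁|Fl.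
module Submission where

open import Defs
open import Data.Nat using (ℕ; zero; suc; _≤_; _<_; s≤s)
open import Data.Nat.Properties
  using (≤-refl; ≤-trans; ≤-reflexive; ≤-antisym; n≤1+n; <⇒≱; ≰⇒>; n≤0⇒n≡0; _≤?_;
         module ≤-Reasoning)
open import Data.List using (List; []; _∷_; allFin)
import Data.List.Membership.Propositional as List
open import Data.List.Membership.Propositional.Properties using (∈-allFin)
open import Data.List.Relation.Unary.Any using (here; there)
open import Data.Bool using (true; false)
open import Data.Fin using (Fin; zero; suc)
open import Data.Fin.Properties using (suc-injective)
open import Data.Fin.Subset
open import Data.Fin.Subset.Properties
open import Data.Vec using ([]; _∷_; here; there)
open import Data.Vec.Properties using (lookup∘tabulate; []=⇒lookup; lookup⇒[]=)
open import Data.Product using (Σ; ∃; ∃₂; _×_; _,_; proj₁; proj₂)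
open import Data.Sum using (_⊎_; inj₁; inj₂; [_,_])
open import Data.Empty using (⊥-elim)
open import Relation.Nullary using (¬_; Dec; yes; no)
open import Relation.Binary.PropositionalEquality
  using (_≡_; _≢_; refl; sym; trans; cong; cong₂; subst; subst₂; module ≡-Reasoning)
open import Function using (_∘_)
open import Function.Definitions using (Injective)
open import Algebra.Bundles using (CommutativeRing)

private variable
  k m n m₁ m₂ n₁ n₂ : ℕ

-- Subsets: preimages and images

module _ {f : Fin m → Fin n} {Y : Subset n} {i : Fin m} where

  ∈-preimage⁺ : f i ∈ Y → i ∈ preimage f Y
  ∈-preimage⁺ p = lookup⇒[]= i _ (trans (lookup∘tabulate _ i) ([]=⇒lookup p))

  ∈-preimage⁻ : i ∈ preimage f Y → f i ∈ Y
  ∈-preimage⁻ p = lookup⇒[]= (f i) Y (trans (sym (lookup∘tabulate _ i)) ([]=⇒lookup p))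

image : (Fin m → Fin n) → Subset m → Subset n
image {zero}  f []          = ⊥
image {suc m} f (true ∷ Z)  = image (f ∘ suc) Z ∪ ⁅ f zero ⁆
image {suc m} f (false ∷ Z) = image (f ∘ suc) Z

∈-image⁺ : ∀ (f : Fin m → Fin n) Z {i} → i ∈ Z → f i ∈ image f Z
∈-image⁺ f (true ∷ Z)  here      = q⊆p∪q (image (f ∘ suc) Z) _ (x∈⁅x⁆ (f zero))
∈-image⁺ f (true ∷ Z)  (there p) = p⊆p∪q _ (∈-image⁺ (f ∘ suc) Z p)
∈-image⁺ f (false ∷ Z) (there p) = ∈-image⁺ (f ∘ suc) Z p

∈-image⁻ : ∀ (f : Fin m → Fin n) Z {j} → j ∈ image f Z → ∃ λ i → i ∈ Z × f i ≡ j
∈-image⁻ {zero}  f []          p = ⊥-elim (∉⊥ p)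
∈-image⁻ {suc m} f (true ∷ Z)  p with x∈p∪q⁻ (image (f ∘ suc) Z) _ p
... | inj₁ p′ = let i , i∈Z , fi≡j = ∈-image⁻ (f ∘ suc) Z p′ in suc i , there i∈Z , fi≡j
... | inj₂ p′ = zero , here , sym (x∈⁅y⁆⇒x≡y _ p′)
∈-image⁻ {suc m} f (false ∷ Z) p =
  let i , i∈Z , fi≡j = ∈-image⁻ (f ∘ suc) Z p in suc i , there i∈Z , fi≡j

module _ (f : Fin m → Fin n) where

  image-mono : ∀ {Z Z′} → Z ⊆ Z′ → image f Z ⊆ image f Z′
  image-mono {Z} {Z′} Z⊆Z′ p with ∈-image⁻ f Z p
  ... | i , i∈Z , refl = ∈-image⁺ f Z′ (Z⊆Z′ i∈Z)

  image-∪ : ∀ Z Z′ → image f (Z ∪ Z′) ≡ image f Z ∪ image f Z′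
  image-∪ Z Z′ = ⊆-antisym to from
    where
    to : image f (Z ∪ Z′) ⊆ image f Z ∪ image f Z′
    to p with ∈-image⁻ f (Z ∪ Z′) p
    ... | i , i∈ , refl = [ p⊆p∪q _ ∘ ∈-image⁺ f Z , q⊆p∪q _ _ ∘ ∈-image⁺ f Z′ ] (x∈p∪q⁻ Z Z′ i∈)
    from : image f Z ∪ image f Z′ ⊆ image f (Z ∪ Z′)
    from p = [ image-mono (p⊆p∪q Z′) , image-mono (q⊆p∪q Z Z′) ] (x∈p∪q⁻ _ _ p)

  image-∩⊆ : ∀ Z Z′ → image f (Z ∩ Z′) ⊆ image f Z ∩ image f Z′
  image-∩⊆ Z Z′ p = x∈p∩q⁺ (image-mono (p∩q⊆p Z Z′) p , image-mono (p∩q⊆q Z Z′) p)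

  image-⁅⁆ : ∀ i → image f ⁅ i ⁆ ≡ ⁅ f i ⁆
  image-⁅⁆ i = ⊆-antisym to (λ p → subst (_∈ image f ⁅ i ⁆) (sym (x∈⁅y⁆⇒x≡y _ p)) (∈-image⁺ f _ (x∈⁅x⁆ i)))
    where
    to : image f ⁅ i ⁆ ⊆ ⁅ f i ⁆
    to p with ∈-image⁻ f ⁅ i ⁆ p
    ... | i′ , i′∈ , refl = subst (λ x → f x ∈ ⁅ f i ⁆) (sym (x∈⁅y⁆⇒x≡y i i′∈)) (x∈⁅x⁆ (f i))

  image-∪⁅⁆ : ∀ Z i → image f (Z ∪ ⁅ i ⁆) ≡ image f Z ∪ ⁅ f i ⁆
  image-∪⁅⁆ Z i = trans (image-∪ Z ⁅ i ⁆) (cong (image f Z ∪_) (image-⁅⁆ i))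

  image-⊆ : ∀ {Z Y} → (∀ {i} → i ∈ Z → f i ∈ Y) → image f Z ⊆ Y
  image-⊆ {Z} {Y} into p with ∈-image⁻ f Z p
  ... | i , i∈Z , refl = into i∈Z

  image-preimage : ∀ Y → (∀ {j} → j ∈ Y → ∃ λ i → f i ≡ j) → image f (preimage f Y) ≡ Y
  image-preimage Y onto = ⊆-antisym (image-⊆ ∈-preimage⁻) from
    where
    from : Y ⊆ image f (preimage f Y)
    from p with onto p
    ... | i , refl = ∈-image⁺ f _ (∈-preimage⁺ p)

  module _ (f-inj : Injective _≡_ _≡_ f) where

    ∉-image : ∀ {Z i} → i ∉ Z → f i ∉ image f Z
    ∉-image {Z} i∉Z p with ∈-image⁻ f Z p
    ... | i′ , i′∈Z , fi′≡fi = i∉Z (subst (_∈ Z) (f-inj fi′≡fi) i′∈Z)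

    image-∩ : ∀ Z Z′ → image f (Z ∩ Z′) ≡ image f Z ∩ image f Z′
    image-∩ Z Z′ = ⊆-antisym (image-∩⊆ Z Z′) from
      where
      from : image f Z ∩ image f Z′ ⊆ image f (Z ∩ Z′)
      from p with x∈p∩q⁻ _ _ p
      ... | p₁ , p₂ with ∈-image⁻ f Z p₁ | ∈-image⁻ f Z′ p₂
      ... | i , i∈Z , refl | i′ , i′∈Z′ , fi′≡fi =
        ∈-image⁺ f _ (x∈p∩q⁺ (i∈Z , subst (_∈ Z′) (f-inj fi′≡fi) i′∈Z′))

    preimage-image : ∀ Z → preimage f (image f Z) ≡ Z
    preimage-image Z = ⊆-antisym to (∈-preimage⁺ ∘ ∈-image⁺ f Z)
      where
      to : preimage f (image f Z) ⊆ Z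
      to p with ∈-image⁻ f Z (∈-preimage⁻ p)
      ... | i , i∈Z , fi≡fj = subst (_∈ Z) (f-inj fi≡fj) i∈Z

∣p∪⁅x⁆∣≤1+∣p∣ : ∀ (p : Subset n) x → ∣ p ∪ ⁅ x ⁆ ∣ ≤ suc ∣ p ∣
∣p∪⁅x⁆∣≤1+∣p∣ (true ∷ p)  zero    rewrite ∪-identityʳ p = n≤1+n _
∣p∪⁅x⁆∣≤1+∣p∣ (false ∷ p) zero    rewrite ∪-identityʳ p = ≤-refl
∣p∪⁅x⁆∣≤1+∣p∣ (true ∷ p)  (suc x) = s≤s (∣p∪⁅x⁆∣≤1+∣p∣ p x)
∣p∪⁅x⁆∣≤1+∣p∣ (false ∷ p) (suc x) = ∣p∪⁅x⁆∣≤1+∣p∣ p x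

x∉p⇒∣p∪⁅x⁆∣≡1+∣p∣ : ∀ {p : Subset n} {x} → x ∉ p → ∣ p ∪ ⁅ x ⁆ ∣ ≡ suc ∣ p ∣
x∉p⇒∣p∪⁅x⁆∣≡1+∣p∣ {p = true ∷ p}  {zero}  x∉p = ⊥-elim (x∉p here)
x∉p⇒∣p∪⁅x⁆∣≡1+∣p∣ {p = false ∷ p} {zero}  x∉p = cong suc (cong ∣_∣ (∪-identityʳ p))
x∉p⇒∣p∪⁅x⁆∣≡1+∣p∣ {p = true ∷ p}  {suc x} x∉p = cong suc (x∉p⇒∣p∪⁅x⁆∣≡1+∣p∣ (x∉p ∘ there))
x∉p⇒∣p∪⁅x⁆∣≡1+∣p∣ {p = false ∷ p} {suc x} x∉p = x∉p⇒∣p∪⁅x⁆∣≡1+∣p∣ (x∉p ∘ there)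

∣image∣≤∣p∣ : ∀ (f : Fin m → Fin n) Z → ∣ image f Z ∣ ≤ ∣ Z ∣
∣image∣≤∣p∣ {zero}  {n} f []          = ≤-reflexive (∣⊥∣≡0 n)
∣image∣≤∣p∣ {suc m}     f (true ∷ Z)  =
  ≤-trans (∣p∪⁅x⁆∣≤1+∣p∣ (image (f ∘ suc) Z) (f zero)) (s≤s (∣image∣≤∣p∣ (f ∘ suc) Z))
∣image∣≤∣p∣ {suc m}     f (false ∷ Z) = ∣image∣≤∣p∣ (f ∘ suc) Z

∣image∣≡∣p∣ : ∀ (f : Fin m → Fin n) → Injective _≡_ _≡_ f → ∀ Z → ∣ image f Z ∣ ≡ ∣ Z ∣
∣image∣≡∣p∣ {zero}  {n} f f-inj []          = ∣⊥∣≡0 n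
∣image∣≡∣p∣ {suc m}     f f-inj (true ∷ Z)  =
  trans (x∉p⇒∣p∪⁅x⁆∣≡1+∣p∣ (∉-image f f-inj {false ∷ Z} {zero} λ ()))
        (cong suc (∣image∣≡∣p∣ (f ∘ suc) (suc-injective ∘ f-inj) Z))
∣image∣≡∣p∣ {suc m}     f f-inj (false ∷ Z) = ∣image∣≡∣p∣ (f ∘ suc) (suc-injective ∘ f-inj) Z

-- Matroids

Spans : SimpleMatroid n → Subset n → Fin n → Set
Spans M B e = r M (B ∪ ⁅ e ⁆) ≤ r M B

IsBasis : SimpleMatroid n → Subset n → Subset n → Set
IsBasis M Y B = B ⊆ Y × Independent M B × (∀ {e} → e ∈ Y → Spans M B e)

module _ (M : SimpleMatroid n) where

  open import Data.Nat using (_+_)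
  open import Data.Nat.Properties
    using (+-comm; +-assoc; +-mono-≤; +-monoˡ-<; +-cancelʳ-≤; +-cancelˡ-≤; +-cancelˡ-<;
           +-commutativeSemigroup)
  import Algebra.Properties.CommutativeSemigroup +-commutativeSemigroup as ℕ+

  r-submod-⊆ : ∀ {U C} A B → U ⊆ A ∪ B → C ⊆ A ∩ B → r M U + r M C ≤ r M A + r M B
  r-submod-⊆ A B U⊆A∪B C⊆A∩B =
    ≤-trans (+-mono-≤ (r-mono M U⊆A∪B) (r-mono M C⊆A∩B)) (r-submod M A B)

  ⊆-flat⇒r<r∪⁅⁆ : ∀ {X Z e} → IsFlat M X → e ∉ X → Z ⊆ X → r M Z < r M (Z ∪ ⁅ e ⁆)
  ⊆-flat⇒r<r∪⁅⁆ {X} {Z} {e} X-flat e∉X Z⊆X = +-cancelˡ-< (r M X) _ _ (begin-strict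
    r M X + r M Z               <⟨ +-monoˡ-< (r M Z) (X-flat e e∉X) ⟩
    r M (X ∪ ⁅ e ⁆) + r M Z     ≤⟨ r-submod-⊆ (Z ∪ ⁅ e ⁆) X X∪e⊆ Z⊆ ⟩
    r M (Z ∪ ⁅ e ⁆) + r M X     ≡⟨ +-comm _ (r M X) ⟩
    r M X + r M (Z ∪ ⁅ e ⁆)     ∎)
    where
    open ≤-Reasoning
    X∪e⊆ : X ∪ ⁅ e ⁆ ⊆ (Z ∪ ⁅ e ⁆) ∪ X
    X∪e⊆ p = [ q⊆p∪q _ _ , p⊆p∪q X ∘ q⊆p∪q Z _ ] (x∈p∪q⁻ X _ p)
    Z⊆ : Z ⊆ (Z ∪ ⁅ e ⁆) ∩ X
    Z⊆ p = x∈p∩q⁺ (p⊆p∪q _ p , Z⊆X p)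

  flat-∩ : ∀ {X Y} → IsFlat M X → IsFlat M Y → IsFlat M (X ∩ Y)
  flat-∩ {X} {Y} X-flat Y-flat e e∉X∩Y with e ∈? X
  ... | yes e∈X = ⊆-flat⇒r<r∪⁅⁆ Y-flat (λ e∈Y → e∉X∩Y (x∈p∩q⁺ (e∈X , e∈Y))) (p∩q⊆q X Y)
  ... | no  e∉X = ⊆-flat⇒r<r∪⁅⁆ X-flat e∉X (p∩q⊆p X Y)

  spans-mono : ∀ {B B′ e} → B ⊆ B′ → Spans M B e → Spans M B′ e
  spans-mono {B} {B′} {e} B⊆B′ B-spans = +-cancelʳ-≤ (r M B) _ _ (begin
    r M (B′ ∪ ⁅ e ⁆) + r M B   ≤⟨ r-submod-⊆ B′ (B ∪ ⁅ e ⁆) B′∪e⊆ B⊆ ⟩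
    r M B′ + r M (B ∪ ⁅ e ⁆)   ≤⟨ +-mono-≤ (≤-refl {r M B′}) B-spans ⟩
    r M B′ + r M B             ∎)
    where
    open ≤-Reasoning
    B′∪e⊆ : B′ ∪ ⁅ e ⁆ ⊆ B′ ∪ (B ∪ ⁅ e ⁆)
    B′∪e⊆ p = [ p⊆p∪q _ , q⊆p∪q B′ _ ∘ q⊆p∪q B _ ] (x∈p∪q⁻ B′ _ p)
    B⊆ : B ⊆ B′ ∩ (B ∪ ⁅ e ⁆)
    B⊆ p = x∈p∩q⁺ (B⊆B′ p , p⊆p∪q _ p)

  ∈⇒spans : ∀ {B e} → e ∈ B → Spans M B e
  ∈⇒spans {B} {e} e∈B = r-mono M B∪e⊆B
    where
    B∪e⊆B : B ∪ ⁅ e ⁆ ⊆ B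
    B∪e⊆B p = [ (λ p → p) , (λ p → subst (_∈ B) (sym (x∈⁅y⁆⇒x≡y e p)) e∈B) ] (x∈p∪q⁻ B _ p)

  ¬spans⇒independent : ∀ {B e} → Independent M B → ¬ Spans M B e → Independent M (B ∪ ⁅ e ⁆)
  ¬spans⇒independent {B} {e} B-indep ¬spans = ≤-antisym (r-bound M _) (begin
    ∣ B ∪ ⁅ e ⁆ ∣  ≤⟨ ∣p∪⁅x⁆∣≤1+∣p∣ B e ⟩
    suc ∣ B ∣      ≡⟨ cong suc (sym B-indep) ⟩
    suc (r M B)    ≤⟨ ≰⇒> ¬spans ⟩
    r M (B ∪ ⁅ e ⁆) ∎)
    where open ≤-Reasoning

  dependent⇒spans : ∀ {B e} → Independent M B → ¬ Independent M (B ∪ ⁅ e ⁆) → Spans M B e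
  dependent⇒spans {B} {e} B-indep dep with r M (B ∪ ⁅ e ⁆) ≤? r M B
  ... | yes spans = spans
  ... | no  ¬spans = ⊥-elim (dep (¬spans⇒independent B-indep ¬spans))

  spans⇒dependent : ∀ {B e} → e ∉ B → Independent M B → Spans M B e → ¬ Independent M (B ∪ ⁅ e ⁆)
  spans⇒dependent {B} {e} e∉B B-indep spans B∪e-indep = <⇒≱ r<r∪e spans
    where
    r<r∪e : r M B < r M (B ∪ ⁅ e ⁆)
    r<r∪e = ≤-reflexive (sym (trans B∪e-indep (trans (x∉p⇒∣p∪⁅x⁆∣≡1+∣p∣ e∉B) (cong suc (sym B-indep)))))

  ⊥-independent : Independent M ⊥
  ⊥-independent = trans (n≤0⇒n≡0 (subst (r M ⊥ ≤_) (∣⊥∣≡0 n) (r-bound M ⊥))) (sym (∣⊥∣≡0 n))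

  basis : ∀ Y → ∃ (IsBasis M Y)
  basis Y with greedy (allFin n) (⊥-elim ∘ ∉⊥) ⊥-independent
    where
    greedy : ∀ (L : List (Fin n)) {B} → B ⊆ Y → Independent M B →
             ∃ λ B′ → B ⊆ B′ × B′ ⊆ Y × Independent M B′ × (∀ {e} → e List.∈ L → e ∈ Y → Spans M B′ e)
    greedy []      B⊆Y B-indep = _ , (λ p → p) , B⊆Y , B-indep , λ ()
    greedy (e ∷ L) {B} B⊆Y B-indep with e ∈? Y | r M (B ∪ ⁅ e ⁆) ≤? r M B
    ... | no e∉Y | _ with greedy L B⊆Y B-indep
    ...   | B′ , B⊆B′ , B′⊆Y , B′-indep , spans =
      B′ , B⊆B′ , B′⊆Y , B′-indep , λ { (here refl) e∈Y → ⊥-elim (e∉Y e∈Y) ; (there p) → spans p }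
    greedy (e ∷ L) {B} B⊆Y B-indep | yes _ | yes B-spans with greedy L B⊆Y B-indep
    ...   | B′ , B⊆B′ , B′⊆Y , B′-indep , spans =
      B′ , B⊆B′ , B′⊆Y , B′-indep , λ { (here refl) _ → spans-mono B⊆B′ B-spans ; (there p) → spans p }
    greedy (e ∷ L) {B} B⊆Y B-indep | yes e∈Y | no ¬B-spans
      with greedy L (λ p → [ B⊆Y , (λ p → subst (_∈ Y) (sym (x∈⁅y⁆⇒x≡y e p)) e∈Y) ] (x∈p∪q⁻ B _ p))
                    (¬spans⇒independent B-indep ¬B-spans)
    ...   | B′ , B∪e⊆B′ , B′⊆Y , B′-indep , spans =
      B′ , B∪e⊆B′ ∘ p⊆p∪q _ , B′⊆Y , B′-indep ,
      λ { (here refl) _ → ∈⇒spans (B∪e⊆B′ (q⊆p∪q B _ (x∈⁅x⁆ e))) ; (there p) → spans p }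
  ... | B , _ , B⊆Y , B-indep , spans = B , B⊆Y , B-indep , λ e∈Y → spans (∈-allFin _) e∈Y

  modular-∩-flat : ∀ {T S X} → IsModularFlat M T → IsFlat M X → X ⊆ S →
                   r M ((T ∩ S) ∪ X) + r M ((T ∩ S) ∩ X) ≡ r M (T ∩ S) + r M X
  modular-∩-flat {T} {S} {X} (_ , T-modular) X-flat X⊆S =
    ≤-antisym (r-submod M (T ∩ S) X) (+-cancelˡ-≤ (r M T) _ _ (begin
      r M T + (r M T′ + r M X)                      ≡⟨ ℕ+.x∙yz≈y∙xz (r M T) (r M T′) (r M X) ⟩
      r M T′ + (r M T + r M X)                      ≡⟨ cong (r M T′ +_) (T-modular X X-flat) ⟨
      r M T′ + (r M (T ∪ X) + r M (T ∩ X))          ≡⟨ ℕ+.x∙yz≈yx∙z (r M T′) (r M (T ∪ X)) (r M (T ∩ X)) ⟩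
      (r M (T ∪ X) + r M T′) + r M (T ∩ X)          ≤⟨ +-mono-≤ (r-submod-⊆ T (T′ ∪ X) T∪X⊆ T′⊆)
                                                                (r-mono M T∩X⊆) ⟩
      (r M T + r M (T′ ∪ X)) + r M (T′ ∩ X)         ≡⟨ +-assoc (r M T) _ _ ⟩
      r M T + (r M (T′ ∪ X) + r M (T′ ∩ X))         ∎))
    where
    open ≤-Reasoning
    T′ : Subset n
    T′ = T ∩ S
    T∪X⊆ : T ∪ X ⊆ T ∪ (T′ ∪ X)
    T∪X⊆ p = [ p⊆p∪q _ , q⊆p∪q T _ ∘ q⊆p∪q T′ X ] (x∈p∪q⁻ T X p)
    T′⊆ : T′ ⊆ T ∩ (T′ ∪ X)
    T′⊆ p = x∈p∩q⁺ (p∩q⊆p T S p , p⊆p∪q X p)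
    T∩X⊆ : T ∩ X ⊆ T′ ∩ X
    T∩X⊆ p = x∈p∩q⁺ (x∈p∩q⁺ (p∩q⊆p T X p , X⊆S (p∩q⊆q T X p)) , p∩q⊆q T X p)

-- Restrictions

record IsEnumeration (ε : Fin m → Fin n) (S : Subset n) : Set where
  field
    injective : Injective _≡_ _≡_ ε
    onto      : ∀ {e} → e ∈ S → ∃ λ a → ε a ≡ e
    into      : ∀ a → ε a ∈ S

  image⊆ : ∀ Z → image ε Z ⊆ S
  image⊆ Z = image-⊆ ε (λ {a} _ → into a)

  preimage-⊤ : preimage ε S ≡ ⊤
  preimage-⊤ = ⊆-antisym ⊆⊤ (λ {a} _ → ∈-preimage⁺ (into a))

  preimage-∩ : ∀ T → preimage ε (T ∩ S) ≡ preimage ε T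
  preimage-∩ T = ⊆-antisym (λ p → ∈-preimage⁺ (p∩q⊆p T S (∈-preimage⁻ {f = ε} p)))
                           (λ {a} p → ∈-preimage⁺ (x∈p∩q⁺ (∈-preimage⁻ {f = ε} {T} p , into a)))

  image-preimage-∩ : ∀ T → image ε (preimage ε T) ≡ T ∩ S
  image-preimage-∩ T = ⊆-antisym (λ p → x∈p∩q⁺ (image-⊆ ε ∈-preimage⁻ p , image⊆ _ p)) from
    where
    from : T ∩ S ⊆ image ε (preimage ε T)
    from p with onto (p∩q⊆q T S p)
    ... | a , refl = ∈-image⁺ ε _ (∈-preimage⁺ (p∩q⊆p T S p))

  image-⊤ : image ε ⊤ ≡ S
  image-⊤ = ⊆-antisym (image⊆ ⊤) from
    where
    from : S ⊆ image ε ⊤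
    from p with onto p
    ... | a , refl = ∈-image⁺ ε ⊤ ∈⊤

enumerate : ∀ (S : Subset n) → ∃₂ λ m (ε : Fin m → Fin n) → IsEnumeration ε S
enumerate []          = 0 , (λ ()) , record { injective = λ { {()} } ; onto = λ () ; into = λ () }
enumerate (false ∷ S) with enumerate S
... | m , ε , ε-enum = m , suc ∘ ε , record
  { injective = injective ∘ suc-injective
  ; onto      = λ { (there p) → let a , εa≡e = onto p in a , cong suc εa≡e }
  ; into      = there ∘ into
  }
  where open IsEnumeration ε-enum
enumerate (true ∷ S) with enumerate S
... | m , ε , ε-enum = suc m , ε′ , record { injective = ε′-inj ; onto = ε′-onto ; into = ε′-into }
  where
  open IsEnumeration ε-enum
  ε′ : Fin (suc m) → Fin (suc _)
  ε′ zero    = zero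
  ε′ (suc a) = suc (ε a)
  ε′-inj : Injective _≡_ _≡_ ε′
  ε′-inj {zero}  {zero}  _ = refl
  ε′-inj {suc a} {suc b} p = cong suc (injective (suc-injective p))
  ε′-onto : ∀ {e} → e ∈ true ∷ S → ∃ λ a → ε′ a ≡ e
  ε′-onto here      = zero , refl
  ε′-onto (there p) = let a , εa≡e = onto p in suc a , cong suc εa≡e
  ε′-into : ∀ a → ε′ a ∈ true ∷ S
  ε′-into zero    = here
  ε′-into (suc a) = there (into a)

record IsRestriction (M′ : SimpleMatroid m) (M : SimpleMatroid n)
                     (κ : Fin m → Fin n) (S : Subset n) : Set where
  field
    enumeration : IsEnumeration κ S
    rank        : ∀ Y → Y ⊆ S → r M′ (preimage κ Y) ≡ r M Y

  open IsEnumeration enumeration public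

  r-image : ∀ Z → r M′ Z ≡ r M (image κ Z)
  r-image Z = trans (cong (r M′) (sym (preimage-image κ injective Z))) (rank _ (image⊆ Z))

  flat-image⁻ : ∀ Z → IsFlat M (image κ Z) → IsFlat M′ Z
  flat-image⁻ Z flat a a∉Z =
    subst₂ _<_ (sym (r-image Z)) (trans (cong (r M) (sym (image-∪⁅⁆ κ Z a))) (sym (r-image _)))
           (flat (κ a) (∉-image κ injective a∉Z))

  flat-image⁺ : IsFlat M S → ∀ Z → IsFlat M′ Z → IsFlat M (image κ Z)
  flat-image⁺ S-flat Z Z-flat e e∉κZ with e ∈? S
  ... | no  e∉S = ⊆-flat⇒r<r∪⁅⁆ M S-flat e∉S (image⊆ Z)
  ... | yes e∈S with onto e∈S
  ...   | a , refl = subst₂ _<_ (r-image Z) (trans (r-image _) (cong (r M) (image-∪⁅⁆ κ Z a)))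
                            (Z-flat a (e∉κZ ∘ ∈-image⁺ κ Z))

  independent-image⁺ : ∀ Z → Independent M′ Z → Independent M (image κ Z)
  independent-image⁺ Z Z-indep =
    trans (sym (r-image Z)) (trans Z-indep (sym (∣image∣≡∣p∣ κ injective Z)))

  independent-image⁻ : ∀ Z → Independent M (image κ Z) → Independent M′ Z
  independent-image⁻ Z κZ-indep = trans (r-image Z) (trans κZ-indep (∣image∣≡∣p∣ κ injective Z))

module _ {M′ : SimpleMatroid m} {M : SimpleMatroid n} {κ S} (R : IsRestriction M′ M κ S) where

  open import Data.Nat using (_+_)
  open IsRestriction R

  modular-preimage : IsFlat M S → ∀ {T} → IsModularFlat M T → IsModularFlat M′ (preimage κ T)
  modular-preimage S-flat {T} T-modular@(T-flat , _) = flat , modular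
    where
    T′ : Subset m
    T′ = preimage κ T
    κT′≡T∩S : image κ T′ ≡ T ∩ S
    κT′≡T∩S = image-preimage-∩ T
    flat : IsFlat M′ T′
    flat = flat-image⁻ T′ (subst (IsFlat M) (sym κT′≡T∩S) (flat-∩ M T-flat S-flat))
    modular : ∀ X → IsFlat M′ X → r M′ (T′ ∪ X) + r M′ (T′ ∩ X) ≡ r M′ T′ + r M′ X
    modular X X-flat = begin
      r M′ (T′ ∪ X) + r M′ (T′ ∩ X)                           ≡⟨ cong₂ _+_ r-∪ r-∩ ⟩
      r M ((T ∩ S) ∪ image κ X) + r M ((T ∩ S) ∩ image κ X)   ≡⟨ modular-∩-flat M T-modular
                                                                   (flat-image⁺ S-flat X X-flat) (image⊆ X) ⟩
      r M (T ∩ S) + r M (image κ X)                           ≡⟨ cong₂ _+_ r-T′ (r-image X) ⟨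
      r M′ T′ + r M′ X                                        ∎
      where
      open ≡-Reasoning
      r-∪ : r M′ (T′ ∪ X) ≡ r M ((T ∩ S) ∪ image κ X)
      r-∪ = trans (r-image _) (cong (r M) (trans (image-∪ κ T′ X) (cong (_∪ image κ X) κT′≡T∩S)))
      r-∩ : r M′ (T′ ∩ X) ≡ r M ((T ∩ S) ∩ image κ X)
      r-∩ = trans (r-image _) (cong (r M) (trans (image-∩ κ injective T′ X) (cong (_∩ image κ X) κT′≡T∩S)))
      r-T′ : r M′ T′ ≡ r M (T ∩ S)
      r-T′ = trans (r-image T′) (cong (r M) κT′≡T∩S)

restriction : ∀ (M : SimpleMatroid n) S →
              Σ ℕ λ m → Σ (SimpleMatroid m) λ M′ → ∃ λ κ → IsRestriction M′ M κ S
restriction M S with enumerate S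
... | m , κ , κ-enum = m , M′ , κ , record
  { enumeration = κ-enum
  ; rank        = λ Y Y⊆S → cong (r M) (image-preimage κ Y (onto ∘ Y⊆S))
  }
  where
  open IsEnumeration κ-enum
  M′ : SimpleMatroid m
  M′ = record
    { r        = λ Z → r M (image κ Z)
    ; r-bound  = λ Z → ≤-trans (r-bound M _) (∣image∣≤∣p∣ κ Z)
    ; r-mono   = λ Z⊆Z′ → r-mono M (image-mono κ Z⊆Z′)
    ; r-submod = λ Z Z′ → r-submod-⊆ M (image κ Z) (image κ Z′)
                            (⊆-reflexive (image-∪ κ Z Z′)) (image-∩⊆ κ Z Z′)
    ; simple₁  = λ a → trans (cong (r M) (image-⁅⁆ κ a)) (simple₁ M (κ a))
    ; simple₂  = λ a b a≢b → trans (cong (r M) (trans (image-∪ κ ⁅ a ⁆ ⁅ b ⁆)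
                                                        (cong₂ _∪_ (image-⁅⁆ κ a) (image-⁅⁆ κ b))))
                                   (simple₂ M (κ a) (κ b) (a≢b ∘ injective))
    }

-- Linear algebra over a finite field

module LinearAlgebra {q : ℕ} (F : FiniteField q) where

  open FiniteField F hiding (zero) renaming (refl to ≈-refl; sym to ≈-sym; trans to ≈-trans)
  open import Algebra.Properties.Ring (CommutativeRing.ring ring)
    using (-‿distribˡ-*; -0#≈0#; -‿+-comm; +-inverseˡ-unique; x∙y⁻¹≈ε⇒x≈y)
  open import Algebra.Properties.Semiring.Sum semiring
    using (sum; sum-syntax; sum-cong-≋; sum-replicate-zero; ∑-comm; ∑-distrib-+;
           *-distribˡ-sum; *-distribʳ-sum)
    public
  open import Relation.Binary.Reasoning.Setoid setoid
  import Data.Vec.Functional as Vector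
  open import Data.Fin.Properties using (_≟_; any?; all?)

  private variable
    d : ℕ

  infix 4 _≈?_
  _≈?_ : ∀ x y → Dec (x ≈ y)
  x ≈? y with enum-sur x | enum-sur y
  ... | i , i≈x | j , j≈y with i ≟ j
  ...   | yes refl = yes (≈-trans (≈-sym i≈x) j≈y)
  ...   | no  i≢j  = no λ x≈y → i≢j (enum-inj i j (≈-trans i≈x (≈-trans x≈y (≈-sym j≈y))))

  sumF≡sum : ∀ (f : Fin k → Carrier) → sumF F f ≡ sum f
  sumF≡sum {zero}  f = refl
  sumF≡sum {suc k} f = cong (f zero +_) (sumF≡sum (f ∘ suc))

  x≈0⇒x*y≈0 : ∀ {x} y → x ≈ 0# → x * y ≈ 0#
  x≈0⇒x*y≈0 y x≈0 = ≈-trans (*-congʳ x≈0) (zeroˡ y)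

  sum-zero : ∀ {f : Fin k → Carrier} → (∀ i → f i ≈ 0#) → sum f ≈ 0#
  sum-zero {k} f≈0 = ≈-trans (sum-cong-≋ f≈0) (sum-replicate-zero k)

  -‿sum : ∀ (f : Fin k → Carrier) → - sum f ≈ sum (λ i → - f i)
  -‿sum {zero}  f = -0#≈0#
  -‿sum {suc k} f = ≈-trans (≈-sym (-‿+-comm (f zero) (sum (f ∘ suc)))) (+-congˡ (-‿sum (f ∘ suc)))

  ∑-‿* : ∀ (f g : Fin k → Carrier) → sum (λ i → - f i * g i) ≈ - sum (λ i → f i * g i)
  ∑-‿* f g = ≈-trans (sum-cong-≋ λ i → ≈-sym (-‿distribˡ-* (f i) (g i))) (≈-sym (-‿sum (λ i → f i * g i)))

  δ : Fin k → Fin k → Carrier → Carrier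
  δ x y v with x ≟ y
  ... | yes _ = v
  ... | no  _ = 0#

  δ-diag : ∀ (x : Fin k) v → δ x x v ≈ v
  δ-diag x v with x ≟ x
  ... | yes _  = ≈-refl
  ... | no x≢x = ⊥-elim (x≢x refl)

  δ-zero : ∀ (x y : Fin k) v → (x ≡ y → v ≈ 0#) → δ x y v ≈ 0#
  δ-zero x y v v≈0 with x ≟ y
  ... | yes x≡y = v≈0 x≡y
  ... | no  _   = ≈-refl

  δ-≢ : ∀ (x y : Fin k) v → x ≢ y → δ x y v ≈ 0#
  δ-≢ x y v x≢y = δ-zero x y v (⊥-elim ∘ x≢y)

  δ-comm : ∀ (x y : Fin k) v → δ x y v ≈ δ y x v
  δ-comm x y v with x ≟ y
  ... | yes refl = ≈-sym (δ-diag x v)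
  ... | no  x≢y  = ≈-sym (δ-≢ y x v (x≢y ∘ sym))

  δ-∘ : ∀ (f : Fin k → Fin m) → Injective _≡_ _≡_ f → ∀ x y v → δ (f x) (f y) v ≈ δ x y v
  δ-∘ f f-inj x y v with x ≟ y
  ... | yes refl = δ-diag (f x) v
  ... | no  x≢y  = δ-≢ (f x) (f y) v (x≢y ∘ f-inj)

  δ-*ʳ : ∀ (x y : Fin k) v w → δ x y v * w ≈ δ x y (v * w)
  δ-*ʳ x y v w with x ≟ y
  ... | yes _ = ≈-refl
  ... | no  _ = zeroˡ w

  ∑-δ : ∀ (x : Fin k) (h : Fin k → Carrier) → sum (λ j → δ x j (h j)) ≈ h x
  ∑-δ {suc k} zero    h =
    ≈-trans (+-cong (δ-diag {suc k} zero (h zero)) (sum-zero λ j → δ-≢ zero (suc j) (h (suc j)) λ ()))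
            (+-identityʳ (h zero))
  ∑-δ {suc k} (suc x) h =
    ≈-trans (+-cong (δ-≢ (suc x) zero (h zero) λ ())
                    (≈-trans (sum-cong-≋ λ j → δ-∘ suc suc-injective x j (h (suc j))) (∑-δ x (h ∘ suc))))
            (+-identityˡ (h (suc x)))

  ∑-δ′ : ∀ (x : Fin k) (h : Fin k → Carrier) → sum (λ j → δ j x (h j)) ≈ h x
  ∑-δ′ x h = ≈-trans (sum-cong-≋ λ j → δ-comm j x (h j)) (∑-δ x h)

  module _ (κ : Fin m → Fin n) (κ-inj : Injective _≡_ _≡_ κ) where

    ∑-image : ∀ (g : Fin n → Carrier) → (∀ j → (∀ a → κ a ≢ j) → g j ≈ 0#) → sum g ≈ sum (g ∘ κ)
    ∑-image g g-vanishes = begin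
      sum g                                        ≈⟨ sum-cong-≋ g≈ ⟩
      sum (λ j → sum (λ a → δ (κ a) j (g (κ a))))  ≈⟨ ∑-comm (λ j a → δ (κ a) j (g (κ a))) ⟩
      sum (λ a → sum (λ j → δ (κ a) j (g (κ a))))  ≈⟨ sum-cong-≋ (λ a → ∑-δ (κ a) (λ _ → g (κ a))) ⟩
      sum (g ∘ κ)                                  ∎
      where
      g≈ : ∀ j → g j ≈ sum (λ a → δ (κ a) j (g (κ a)))
      g≈ j with any? (λ a → κ a ≟ j)
      ... | yes (a , refl) = ≈-sym (≈-trans (sum-cong-≋ λ b → δ-∘ κ κ-inj b a (g (κ b))) (∑-δ′ a (g ∘ κ)))
      ... | no  ∄a         = ≈-trans (g-vanishes j (λ a κa≡j → ∄a (a , κa≡j)))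
                                     (≈-sym (sum-zero λ a → δ-≢ (κ a) j _ λ κa≡j → ∄a (a , κa≡j)))

    extend : (Fin m → Carrier) → Fin n → Carrier
    extend c j = sum (λ a → δ (κ a) j (c a))

    extend-∘ : ∀ c a → extend c (κ a) ≈ c a
    extend-∘ c a = ≈-trans (sum-cong-≋ λ b → δ-∘ κ κ-inj b a (c b)) (∑-δ′ a c)

    extend-zero : ∀ c j → (∀ a → κ a ≡ j → c a ≈ 0#) → extend c j ≈ 0#
    extend-zero c j c≈0 = sum-zero λ a → δ-zero (κ a) j (c a) (c≈0 a)

    module _ (φ : Fin n → Fin k → Carrier) (Z : Subset m) where

      linIndep-image⇒∘ : LinIndep F φ (image κ Z) → LinIndep F (φ ∘ κ) Z
      linIndep-image⇒∘ L c c-supp c-rel a = ≈-trans (≈-sym (extend-∘ c a)) (L (extend c) supp rel (κ a))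
        where
        supp : ∀ j → j ∉ image κ Z → extend c j ≈ 0#
        supp j j∉κZ = extend-zero c j λ a κa≡j →
          c-supp a λ a∈Z → j∉κZ (subst (_∈ image κ Z) κa≡j (∈-image⁺ κ Z a∈Z))
        rel : ∀ i → sumF F (λ j → extend c j * φ j i) ≈ 0#
        rel i = begin
          sumF F (λ j → extend c j * φ j i)        ≡⟨ sumF≡sum (λ j → extend c j * φ j i) ⟩
          sum (λ j → extend c j * φ j i)           ≈⟨ ∑-image _ (λ j ∄a → x≈0⇒x*y≈0 (φ j i)
                                                        (extend-zero c j λ a κa≡j → ⊥-elim (∄a a κa≡j))) ⟩
          sum (λ a → extend c (κ a) * φ (κ a) i)   ≈⟨ sum-cong-≋ (λ a → *-congʳ (extend-∘ c a)) ⟩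
          sum (λ a → c a * φ (κ a) i)              ≡⟨ sumF≡sum (λ a → c a * φ (κ a) i) ⟨
          sumF F (λ a → c a * φ (κ a) i)           ≈⟨ c-rel i ⟩
          0#                                       ∎

      linIndep-∘⇒image : LinIndep F (φ ∘ κ) Z → LinIndep F φ (image κ Z)
      linIndep-∘⇒image L c c-supp c-rel = c≈0
        where
        c∘κ≈0 : ∀ a → c (κ a) ≈ 0#
        c∘κ≈0 = L (c ∘ κ) (λ a a∉Z → c-supp (κ a) (∉-image κ κ-inj a∉Z)) λ i → begin
          sumF F (λ a → c (κ a) * φ (κ a) i)   ≡⟨ sumF≡sum (λ a → c (κ a) * φ (κ a) i) ⟩
          sum (λ a → c (κ a) * φ (κ a) i)      ≈⟨ ∑-image _ (λ j ∄a → x≈0⇒x*y≈0 (φ j i) (c-supp j λ j∈κZ →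
                                                    let a , _ , κa≡j = ∈-image⁻ κ Z j∈κZ in ∄a a κa≡j)) ⟨
          sum (λ j → c j * φ j i)              ≡⟨ sumF≡sum (λ j → c j * φ j i) ⟨
          sumF F (λ j → c j * φ j i)           ≈⟨ c-rel i ⟩
          0#                                   ∎
        c≈0 : ∀ j → c j ≈ 0#
        c≈0 j with any? (λ a → κ a ≟ j)
        ... | yes (a , refl) = c∘κ≈0 a
        ... | no  ∄a         = c-supp j λ j∈κZ → let a , _ , κa≡j = ∈-image⁻ κ Z j∈κZ in ∄a (a , κa≡j)

  LinIndependent : (Fin d → Fin k → Carrier) → Set
  LinIndependent {d} ψ = ∀ (c : Fin d → Carrier) → (∀ i → ∑[ b < d ] (c b * ψ b i) ≈ 0#) → ∀ b → c b ≈ 0#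

  module _ (ψ : Fin d → Fin k → Carrier) where

    linIndep-⊤⇒ : LinIndep F ψ ⊤ → LinIndependent ψ
    linIndep-⊤⇒ L c rel =
      L c (λ b b∉⊤ → ⊥-elim (b∉⊤ ∈⊤)) (λ i → ≈-trans (reflexive (sumF≡sum (λ b → c b * ψ b i))) (rel i))

    linIndep-⊤⇐ : LinIndependent ψ → LinIndep F ψ ⊤
    linIndep-⊤⇐ L c _ rel = L c λ i → ≈-trans (reflexive (sym (sumF≡sum (λ b → c b * ψ b i)))) (rel i)

    coordinates-unique : LinIndependent ψ → ∀ {u v : Fin d → Carrier} →
      (∀ i → ∑[ b < d ] (u b * ψ b i) ≈ ∑[ b < d ] (v b * ψ b i)) → ∀ b → u b ≈ v b
    coordinates-unique L {u} {v} u≈v b = x∙y⁻¹≈ε⇒x≈y (u b) (v b) (L (λ b → u b + - v b) rel b)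
      where
      rel : ∀ i → ∑[ b < d ] ((u b + - v b) * ψ b i) ≈ 0#
      rel i = begin
        ∑[ b < d ] ((u b + - v b) * ψ b i)                       ≈⟨ sum-cong-≋ (λ b → distribʳ (ψ b i) (u b) (- v b)) ⟩
        ∑[ b < d ] (u b * ψ b i + - v b * ψ b i)                 ≈⟨ ∑-distrib-+ (λ b → u b * ψ b i) (λ b → - v b * ψ b i) ⟩
        ∑[ b < d ] (u b * ψ b i) + ∑[ b < d ] (- v b * ψ b i)    ≈⟨ +-cong (u≈v i) (∑-‿* v (λ b → ψ b i)) ⟩
        ∑[ b < d ] (v b * ψ b i) + - ∑[ b < d ] (v b * ψ b i)    ≈⟨ -‿inverseʳ _ ⟩
        0#                                                       ∎

  InSpan : (Fin d → Fin k → Carrier) → (Fin k → Carrier) → Set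
  InSpan {d} ψ x = ∃ λ (v : Fin d → Carrier) → ∀ i → x i ≈ ∑[ b < d ] (v b * ψ b i)

  ∷-resp : ∀ {a} {u v : Fin d → Carrier} → (∀ b → u b ≈ v b) → ∀ b → (a Vector.∷ u) b ≈ (a Vector.∷ v) b
  ∷-resp u≈v zero    = ≈-refl
  ∷-resp u≈v (suc b) = u≈v b

  ∃-vector? : ∀ d {P : (Fin d → Carrier) → Set} → (∀ {u v : Fin d → Carrier} → (∀ b → u b ≈ v b) → P u → P v) →
              (∀ v → Dec (P v)) → Dec (∃ P)
  ∃-vector? zero P-resp P? with P? (λ ())
  ... | yes p  = yes (_ , p)
  ... | no  ¬p = no λ (_ , p) → ¬p (P-resp (λ ()) p)
  ∃-vector? (suc d) {P} P-resp P? with any? (λ x → ∃-vector? d (P-resp ∘ ∷-resp) (P? ∘ (enum x Vector.∷_)))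
  ... | yes (_ , _ , p) = yes (_ , p)
  ... | no  ∄x          = no λ (v , p) → let x , x≈v₀ = enum-sur (v zero) in
                          ∄x (x , v ∘ suc , P-resp (λ { zero → ≈-sym x≈v₀ ; (suc b) → ≈-refl }) p)

  inSpan? : ∀ (ψ : Fin d → Fin k → Carrier) x → Dec (InSpan ψ x)
  inSpan? {d} ψ x = ∃-vector? d resp (λ v → all? λ i → x i ≈? ∑[ b < d ] (v b * ψ b i))
    where
    resp : ∀ {u v : Fin d → Carrier} → (∀ b → u b ≈ v b) → (∀ i → x i ≈ ∑[ b < d ] (u b * ψ b i)) →
           ∀ i → x i ≈ ∑[ b < d ] (v b * ψ b i)
    resp u≈v x≈ i = ≈-trans (x≈ i) (sum-cong-≋ λ b → *-congʳ (u≈v b))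

  inSpan-∈ : ∀ (ψ : Fin d → Fin k → Carrier) b → InSpan ψ (ψ b)
  inSpan-∈ {d} ψ b = (λ b′ → δ b b′ 1#) , λ i → ≈-sym (begin
    ∑[ b′ < d ] (δ b b′ 1# * ψ b′ i)    ≈⟨ sum-cong-≋ (λ b′ → δ-*ʳ b b′ 1# (ψ b′ i)) ⟩
    ∑[ b′ < d ] δ b b′ (1# * ψ b′ i)    ≈⟨ ∑-δ b (λ b′ → 1# * ψ b′ i) ⟩
    1# * ψ b i                          ≈⟨ *-identityˡ (ψ b i) ⟩
    ψ b i                               ∎)

  inSpan-scale : ∀ {ψ : Fin d → Fin k → Carrier} {a x} (v : Fin d → Carrier) → ¬ a ≈ 0# →
                 (∀ i → a * x i ≈ ∑[ b < d ] (v b * ψ b i)) → InSpan ψ x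
  inSpan-scale {d} {ψ = ψ} {a} {x} v a≉0 ax≈ = (λ b → a⁻¹ * v b) , λ i → begin
    x i                              ≈⟨ *-identityˡ (x i) ⟨
    1# * x i                         ≈⟨ *-congʳ (≈-trans (*-comm a⁻¹ a) aa⁻¹≈1) ⟨
    a⁻¹ * a * x i                    ≈⟨ *-assoc a⁻¹ a (x i) ⟩
    a⁻¹ * (a * x i)                  ≈⟨ *-congˡ (ax≈ i) ⟩
    a⁻¹ * ∑[ b < d ] (v b * ψ b i)   ≈⟨ *-distribˡ-sum a⁻¹ (λ b → v b * ψ b i) ⟩
    ∑[ b < d ] (a⁻¹ * (v b * ψ b i)) ≈⟨ sum-cong-≋ (λ b → *-assoc a⁻¹ (v b) (ψ b i)) ⟨
    ∑[ b < d ] (a⁻¹ * v b * ψ b i)   ∎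
    where
    a⁻¹ : Carrier
    a⁻¹ = proj₁ (inverse a a≉0)
    aa⁻¹≈1 : a * a⁻¹ ≈ 1#
    aa⁻¹≈1 = proj₂ (inverse a a≉0)

  module _ (ψ : Fin (suc d) → Fin k → Carrier) where

    inSpan⇒¬linIndep : InSpan (ψ ∘ suc) (ψ zero) → ¬ LinIndependent ψ
    inSpan⇒¬linIndep (v , ψ₀≈) L = 1≉0 (L (1# Vector.∷ λ b → - v b) rel zero)
      where
      rel : ∀ i → 1# * ψ zero i + ∑[ b < d ] (- v b * ψ (suc b) i) ≈ 0#
      rel i = begin
        1# * ψ zero i + ∑[ b < d ] (- v b * ψ (suc b) i)   ≈⟨ +-cong (*-identityˡ _) (∑-‿* v _) ⟩
        ψ zero i + - ∑[ b < d ] (v b * ψ (suc b) i)        ≈⟨ +-congˡ (-‿cong (ψ₀≈ i)) ⟨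
        ψ zero i + - ψ zero i                              ≈⟨ -‿inverseʳ _ ⟩
        0#                                                 ∎

    linIndep-∷ : LinIndependent (ψ ∘ suc) → ¬ InSpan (ψ ∘ suc) (ψ zero) → LinIndependent ψ
    linIndep-∷ L ∉span c rel = c≈0
      where
      c₀≈0 : c zero ≈ 0#
      c₀≈0 with c zero ≈? 0#
      ... | yes c₀≈0 = c₀≈0
      ... | no  c₀≉0 = ⊥-elim (∉span (inSpan-scale (λ b → - c (suc b)) c₀≉0 λ i → begin
        c zero * ψ zero i                             ≈⟨ +-inverseˡ-unique _ _ (rel i) ⟩
        - ∑[ b < d ] (c (suc b) * ψ (suc b) i)        ≈⟨ ∑-‿* (c ∘ suc) _ ⟨
        ∑[ b < d ] (- c (suc b) * ψ (suc b) i)        ∎))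
      c≈0 : ∀ b → c b ≈ 0#
      c≈0 zero    = c₀≈0
      c≈0 (suc b) = L (c ∘ suc) (λ i → begin
        ∑[ b < d ] (c (suc b) * ψ (suc b) i)                       ≈⟨ +-identityˡ _ ⟨
        0# + ∑[ b < d ] (c (suc b) * ψ (suc b) i)                  ≈⟨ +-congʳ (x≈0⇒x*y≈0 _ c₀≈0) ⟨
        c zero * ψ zero i + ∑[ b < d ] (c (suc b) * ψ (suc b) i)   ≈⟨ rel i ⟩
        0#                                                         ∎) b

  module _ {φ : Fin n → Fin k → Carrier} {γ : Fin n → Fin d → Carrier} {ψ : Fin d → Fin k → Carrier}
           {Y : Subset n} (φ≈γψ : ∀ {e} → e ∈ Y → ∀ i → φ e i ≈ ∑[ b < d ] (γ e b * ψ b i)) where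

    ∑-change-coordinates : ∀ (c : Fin n → Carrier) → (∀ e → e ∉ Y → c e ≈ 0#) → ∀ i →
      ∑[ e < n ] (c e * φ e i) ≈ ∑[ b < d ] (∑[ e < n ] (c e * γ e b) * ψ b i)
    ∑-change-coordinates c c-supp i = begin
      ∑[ e < n ] (c e * φ e i)                          ≈⟨ sum-cong-≋ c*φ≈ ⟩
      ∑[ e < n ] (c e * ∑[ b < d ] (γ e b * ψ b i))     ≈⟨ sum-cong-≋ (λ e → *-distribˡ-sum (c e) (λ b → γ e b * ψ b i)) ⟩
      ∑[ e < n ] ∑[ b < d ] (c e * (γ e b * ψ b i))     ≈⟨ ∑-comm (λ e b → c e * (γ e b * ψ b i)) ⟩
      ∑[ b < d ] ∑[ e < n ] (c e * (γ e b * ψ b i))     ≈⟨ sum-cong-≋ (λ b → sum-cong-≋ λ e → *-assoc (c e) (γ e b) (ψ b i)) ⟨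
      ∑[ b < d ] ∑[ e < n ] (c e * γ e b * ψ b i)       ≈⟨ sum-cong-≋ (λ b → *-distribʳ-sum (ψ b i) (λ e → c e * γ e b)) ⟨
      ∑[ b < d ] (∑[ e < n ] (c e * γ e b) * ψ b i)     ∎
      where
      c*φ≈ : ∀ e → c e * φ e i ≈ c e * ∑[ b < d ] (γ e b * ψ b i)
      c*φ≈ e with e ∈? Y
      ... | yes e∈Y = *-congˡ (φ≈γψ e∈Y i)
      ... | no  e∉Y = ≈-trans (x≈0⇒x*y≈0 _ (c-supp e e∉Y)) (≈-sym (x≈0⇒x*y≈0 _ (c-supp e e∉Y)))

    module _ {Z : Subset n} (Z⊆Y : Z ⊆ Y) where

      linIndep⇒linIndep-coordinates : LinIndep F φ Z → LinIndep F γ Z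
      linIndep⇒linIndep-coordinates Lφ c c-supp γ-rel = Lφ c c-supp λ i → begin
        sumF F (λ e → c e * φ e i)                      ≡⟨ sumF≡sum (λ e → c e * φ e i) ⟩
        ∑[ e < n ] (c e * φ e i)                        ≈⟨ ∑-change-coordinates c (λ e → c-supp e ∘ (_∘ Z⊆Y)) i ⟩
        ∑[ b < d ] (∑[ e < n ] (c e * γ e b) * ψ b i)   ≈⟨ sum-zero (λ b → x≈0⇒x*y≈0 (ψ b i) (≈-trans
                                                             (reflexive (sym (sumF≡sum (λ e → c e * γ e b)))) (γ-rel b))) ⟩
        0#                                              ∎

      linIndep-coordinates⇒linIndep : LinIndependent ψ → LinIndep F γ Z → LinIndep F φ Z
      linIndep-coordinates⇒linIndep Lψ Lγ c c-supp φ-rel = Lγ c c-supp λ b → begin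
        sumF F (λ e → c e * γ e b)   ≡⟨ sumF≡sum (λ e → c e * γ e b) ⟩
        ∑[ e < n ] (c e * γ e b)     ≈⟨ Lψ (λ b → ∑[ e < n ] (c e * γ e b)) (λ i → begin
            ∑[ b < d ] (∑[ e < n ] (c e * γ e b) * ψ b i)  ≈⟨ ∑-change-coordinates c (λ e → c-supp e ∘ (_∘ Z⊆Y)) i ⟨
            ∑[ e < n ] (c e * φ e i)                       ≡⟨ sumF≡sum (λ e → c e * φ e i) ⟨
            sumF F (λ e → c e * φ e i)                     ≈⟨ φ-rel i ⟩
            0#                                             ∎) b ⟩
        0#                           ∎

-- Projective geometries

module ProjectiveGeometry {q : ℕ} (F : FiniteField q) where

  open FiniteField F hiding (zero) renaming (refl to ≈-refl; sym to ≈-sym; trans to ≈-trans)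
  open LinearAlgebra F
  open import Relation.Binary.Reasoning.Setoid setoid
  import Data.Vec.Functional as Vector

  Represents : SimpleMatroid n → Subset n → (Fin n → Fin k → Carrier) → Set
  Represents M X φ = ∀ Z → Z ⊆ X → (Independent M Z → LinIndep F φ Z) × (LinIndep F φ Z → Independent M Z)

  Covers : Subset n → (Fin n → Fin k → Carrier) → Set
  Covers {k = k} X φ = ∀ (v : Fin k → Carrier) → ¬ (∀ i → v i ≈ 0#) →
                       ∃ λ e → e ∈ X × ∃ λ a → ∀ i → v i ≈ a * φ e i

  isPG-restriction : ∀ {M′ : SimpleMatroid m} {M : SimpleMatroid n} {κ S Y} →
                     IsRestriction M′ M κ S → Y ⊆ S → IsPGRestriction F M Y → IsPGRestriction F M′ (preimage κ Y)
  isPG-restriction {M′ = M′} {M} {κ} {Y = Y} R Y⊆S (k , φ , φ-represents , φ-covers) =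
    k , φ ∘ κ , represents , covers
    where
    open IsRestriction R
    represents : Represents M′ (preimage κ Y) (φ ∘ κ)
    represents Z Z⊆ = linIndep-image⇒∘ κ injective φ Z ∘ proj₁ φ-represents-κZ ∘ independent-image⁺ Z
                    , independent-image⁻ Z ∘ proj₂ φ-represents-κZ ∘ linIndep-∘⇒image κ injective φ Z
      where
      φ-represents-κZ : (Independent M (image κ Z) → LinIndep F φ (image κ Z))
                      × (LinIndep F φ (image κ Z) → Independent M (image κ Z))
      φ-represents-κZ = φ-represents (image κ Z) (image-⊆ κ (∈-preimage⁻ ∘ Z⊆))
    covers : Covers (preimage κ Y) (φ ∘ κ)
    covers v v≉0 with φ-covers v v≉0
    ... | e , e∈Y , a , v≈aφe with onto (Y⊆S e∈Y)
    ...   | e′ , refl = e′ , ∈-preimage⁺ e∈Y , a , v≈aφe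

  module FlatRestriction {M : SimpleMatroid n} {X Y B : Subset n} {k} {φ : Fin n → Fin k → Carrier}
           (φ-represents : Represents M X φ) (φ-covers : Covers X φ) (Y⊆X : Y ⊆ X) (Y-flat : IsFlat M Y)
           (B-basis : IsBasis M Y B) {d} {β : Fin d → Fin n} (β-enum : IsEnumeration β B) where

    open IsEnumeration β-enum

    B⊆Y : B ⊆ Y
    B⊆Y = proj₁ B-basis

    B-independent : Independent M B
    B-independent = proj₁ (proj₂ B-basis)

    B-spans : ∀ {e} → e ∈ Y → Spans M B e
    B-spans = proj₂ (proj₂ B-basis)

    ψ : Fin d → Fin k → Carrier
    ψ = φ ∘ β

    ψ-linIndep : LinIndependent ψ
    ψ-linIndep = linIndep-⊤⇒ ψ (linIndep-image⇒∘ β injective φ ⊤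
                   (subst (LinIndep F φ) (sym image-⊤) (proj₁ (φ-represents B (Y⊆X ∘ B⊆Y)) B-independent)))

    module _ {e} (e∈X : e ∈ X) (e∉B : e ∉ B) where

      β′ : Fin (suc d) → Fin n
      β′ = e Vector.∷ β

      β′-injective : Injective _≡_ _≡_ β′
      β′-injective {zero}  {zero}  _       = refl
      β′-injective {zero}  {suc b} e≡βb    = ⊥-elim (e∉B (subst (_∈ B) (sym e≡βb) (into b)))
      β′-injective {suc a} {zero}  βa≡e    = ⊥-elim (e∉B (subst (_∈ B) βa≡e (into a)))
      β′-injective {suc a} {suc b} βa≡βb   = cong suc (injective βa≡βb)

      φ-represents-B∪e : (Independent M (B ∪ ⁅ e ⁆) → LinIndep F φ (image β′ ⊤))
                       × (LinIndep F φ (image β′ ⊤) → Independent M (B ∪ ⁅ e ⁆))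
      φ-represents-B∪e rewrite image-⊤ = φ-represents (B ∪ ⁅ e ⁆) B∪e⊆X
        where
        B∪e⊆X : B ∪ ⁅ e ⁆ ⊆ X
        B∪e⊆X p = [ Y⊆X ∘ B⊆Y , (λ p → subst (_∈ X) (sym (x∈⁅y⁆⇒x≡y e p)) e∈X) ] (x∈p∪q⁻ B _ p)

      inSpan⇒spans : InSpan ψ (φ e) → Spans M B e
      inSpan⇒spans φe∈span = dependent⇒spans M B-independent λ B∪e-indep →
        inSpan⇒¬linIndep (φ ∘ β′) φe∈span
          (linIndep-⊤⇒ (φ ∘ β′) (linIndep-image⇒∘ β′ β′-injective φ ⊤ (proj₁ φ-represents-B∪e B∪e-indep)))

      -- InSpan is decidable by exhaustive search over the finite field, so this contrapositive is constructive.
      spans⇒inSpan : Spans M B e → InSpan ψ (φ e)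
      spans⇒inSpan B-spans-e with inSpan? ψ (φ e)
      ... | yes φe∈span = φe∈span
      ... | no  φe∉span = ⊥-elim (spans⇒dependent M e∉B B-independent B-spans-e
              (proj₂ φ-represents-B∪e (linIndep-∘⇒image β′ β′-injective φ ⊤
                (linIndep-⊤⇐ (φ ∘ β′) (linIndep-∷ (φ ∘ β′) ψ-linIndep φe∉span)))))

    coordinates : ∀ {e} → e ∈ Y → InSpan ψ (φ e)
    coordinates {e} e∈Y with e ∈? B
    ... | no  e∉B = spans⇒inSpan (Y⊆X e∈Y) e∉B (B-spans e∈Y)
    ... | yes e∈B with onto e∈B
    ...   | b , refl = inSpan-∈ ψ b

    -- The value off Y is arbitrary and never used.
    γ : Fin n → Fin d → Carrier
    γ e with e ∈? Y
    ... | yes e∈Y = proj₁ (coordinates e∈Y)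
    ... | no  _   = λ _ → 0#

    φ≈γψ : ∀ {e} → e ∈ Y → ∀ i → φ e i ≈ ∑[ b < d ] (γ e b * ψ b i)
    φ≈γψ {e} e∈Y with e ∈? Y
    ... | yes e∈Y′ = proj₂ (coordinates e∈Y′)
    ... | no  e∉Y  = ⊥-elim (e∉Y e∈Y)

    γ-represents : Represents M Y γ
    γ-represents Z Z⊆Y = linIndep⇒linIndep-coordinates φ≈γψ Z⊆Y ∘ proj₁ φ-represents-Z
                       , proj₂ φ-represents-Z ∘ linIndep-coordinates⇒linIndep φ≈γψ Z⊆Y ψ-linIndep
      where
      φ-represents-Z : (Independent M Z → LinIndep F φ Z) × (LinIndep F φ Z → Independent M Z)
      φ-represents-Z = φ-represents Z (Y⊆X ∘ Z⊆Y)

    γ-covers : Covers Y γ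
    γ-covers v v≉0 with φ-covers (λ i → ∑[ b < d ] (v b * ψ b i)) (v≉0 ∘ ψ-linIndep v)
    ... | e , e∈X , a , ∑vψ≈aφe = e , e∈Y , a , v≈aγe
      where
      a≉0 : ¬ a ≈ 0#
      a≉0 a≈0 = v≉0 (ψ-linIndep v λ i → ≈-trans (∑vψ≈aφe i) (x≈0⇒x*y≈0 (φ e i) a≈0))
      e∈Y : e ∈ Y
      e∈Y with e ∈? Y
      ... | yes e∈Y = e∈Y
      ... | no  e∉Y = ⊥-elim (<⇒≱ (Y-flat e e∉Y) (spans-mono M B⊆Y
                        (inSpan⇒spans e∈X (e∉Y ∘ B⊆Y) (inSpan-scale v a≉0 (≈-sym ∘ ∑vψ≈aφe)))))
      v≈aγe : ∀ b → v b ≈ a * γ e b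
      v≈aγe = coordinates-unique ψ ψ-linIndep λ i → begin
        ∑[ b < d ] (v b * ψ b i)           ≈⟨ ∑vψ≈aφe i ⟩
        a * φ e i                          ≈⟨ *-congˡ (φ≈γψ e∈Y i) ⟩
        a * ∑[ b < d ] (γ e b * ψ b i)     ≈⟨ *-distribˡ-sum a (λ b → γ e b * ψ b i) ⟩
        ∑[ b < d ] (a * (γ e b * ψ b i))   ≈⟨ sum-cong-≋ (λ b → *-assoc a (γ e b) (ψ b i)) ⟨
        ∑[ b < d ] (a * γ e b * ψ b i)     ∎

  isPG-flat : ∀ {M : SimpleMatroid n} {X Y} → IsPGRestriction F M X → Y ⊆ X → IsFlat M Y → IsPGRestriction F M Y
  isPG-flat {M = M} {X} {Y} (k , φ , φ-represents , φ-covers) Y⊆X Y-flat with basis M Y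
  ... | B , B-basis with enumerate B
  ...   | d , β , β-enum = d , γ , γ-represents , γ-covers
    where open FlatRestriction {M = M} {X} {φ = φ} φ-represents φ-covers Y⊆X Y-flat B-basis β-enum

-- Generalized parallel connections

module ParallelConnection {q : ℕ} (F : FiniteField q) where

  open ProjectiveGeometry F using (isPG-restriction; isPG-flat)

  module Lift {M′ : SimpleMatroid m} {M : SimpleMatroid n} {ι Fl} (R : IsRestriction M′ M ι Fl)
              {nᵢ} {Mᵢ : SimpleMatroid nᵢ} (ιᵢ : Fin nᵢ → Fin n) (ιᵢ-injective : Injective _≡_ _≡_ ιᵢ)
              {mᵢ} {M′ᵢ : SimpleMatroid mᵢ} {εᵢ} (Rᵢ : IsRestriction M′ᵢ Mᵢ εᵢ (preimage ιᵢ Fl)) where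

    private
      module R  = IsRestriction R
      module Rᵢ = IsRestriction Rᵢ

    j-spec : ∀ a → ∃ λ e → ι e ≡ ιᵢ (εᵢ a)
    j-spec a = R.onto (∈-preimage⁻ (Rᵢ.into a))

    j : Fin mᵢ → Fin m
    j a = proj₁ (j-spec a)

    ι∘j : ∀ a → ι (j a) ≡ ιᵢ (εᵢ a)
    ι∘j a = proj₂ (j-spec a)

    j-injective : Injective _≡_ _≡_ j
    j-injective {a} {a′} ja≡ja′ =
      Rᵢ.injective (ιᵢ-injective (trans (sym (ι∘j a)) (trans (cong ι ja≡ja′) (ι∘j a′))))

    j-onto : ∀ {c e} → ιᵢ c ≡ ι e → ∃ λ a → j a ≡ e
    j-onto {c} {e} ιᵢc≡ιe with Rᵢ.onto (∈-preimage⁺ (subst (_∈ Fl) (sym ιᵢc≡ιe) (R.into e)))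
    ... | a , refl = a , R.injective (trans (ι∘j a) ιᵢc≡ιe)

    image-preimage-j : ∀ X → image εᵢ (preimage j X) ≡ preimage ιᵢ (image ι X)
    image-preimage-j X = ⊆-antisym to from
      where
      to : image εᵢ (preimage j X) ⊆ preimage ιᵢ (image ι X)
      to p with ∈-image⁻ εᵢ (preimage j X) p
      ... | a , a∈ , refl = ∈-preimage⁺ (subst (_∈ image ι X) (ι∘j a) (∈-image⁺ ι X (∈-preimage⁻ a∈)))
      from : preimage ιᵢ (image ι X) ⊆ image εᵢ (preimage j X)
      from {c} p with ∈-image⁻ ι X (∈-preimage⁻ p)
      ... | e , e∈X , ιe≡ιᵢc with j-onto (sym ιe≡ιᵢc)
      ...   | a , refl = subst (_∈ image εᵢ (preimage j X)) (ιᵢ-injective (trans (sym (ι∘j a)) ιe≡ιᵢc))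
                               (∈-image⁺ εᵢ _ (∈-preimage⁺ e∈X))

    r-preimage-j : ∀ X → r M′ᵢ (preimage j X) ≡ r Mᵢ (preimage ιᵢ (image ι X))
    r-preimage-j X = trans (Rᵢ.r-image _) (cong (r Mᵢ) (image-preimage-j X))

    flat-preimage-j⁺ : IsFlat Mᵢ (preimage ιᵢ Fl) → ∀ X →
                       IsFlat M′ᵢ (preimage j X) → IsFlat Mᵢ (preimage ιᵢ (image ι X))
    flat-preimage-j⁺ Flᵢ-flat X flat = subst (IsFlat Mᵢ) (image-preimage-j X) (Rᵢ.flat-image⁺ Flᵢ-flat _ flat)

    flat-preimage-j⁻ : ∀ X → IsFlat Mᵢ (preimage ιᵢ (image ι X)) → IsFlat M′ᵢ (preimage j X)
    flat-preimage-j⁻ X flat = Rᵢ.flat-image⁻ _ (subst (IsFlat Mᵢ) (sym (image-preimage-j X)) flat)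

  module Glue {M′ : SimpleMatroid m} {M : SimpleMatroid n} {ι Fl} (R : IsRestriction M′ M ι Fl)
              {nᵢ} {Mᵢ : SimpleMatroid nᵢ} {ιᵢ : Fin nᵢ → Fin n} (ιᵢ-injective : Injective _≡_ _≡_ ιᵢ)
              {mᵢ} {M′ᵢ : SimpleMatroid mᵢ} {εᵢ} (Rᵢ : IsRestriction M′ᵢ Mᵢ εᵢ (preimage ιᵢ Fl))
              {nₒ} {Mₒ : SimpleMatroid nₒ} {ιₒ : Fin nₒ → Fin n} (ιₒ-injective : Injective _≡_ _≡_ ιₒ)
              {mₒ} {M′ₒ : SimpleMatroid mₒ} {εₒ} (Rₒ : IsRestriction M′ₒ Mₒ εₒ (preimage ιₒ Fl)) where

    private
      module Lᵢ = Lift R ιᵢ ιᵢ-injective Rᵢ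
      module Lₒ = Lift R ιₒ ιₒ-injective Rₒ

    overlap-preimage : ∀ {T} → (∀ a → (a ∈ T → ∃ λ b → ιₒ b ≡ ιᵢ a) × ((∃ λ b → ιₒ b ≡ ιᵢ a) → a ∈ T)) →
      ∀ a → (a ∈ preimage εᵢ T → ∃ λ b → Lₒ.j b ≡ Lᵢ.j a) × ((∃ λ b → Lₒ.j b ≡ Lᵢ.j a) → a ∈ preimage εᵢ T)
    overlap-preimage {T} T-def a = to , from
      where
      to : a ∈ preimage εᵢ T → ∃ λ b → Lₒ.j b ≡ Lᵢ.j a
      to p = let b , ιₒb≡ = proj₁ (T-def (εᵢ a)) (∈-preimage⁻ p) in Lₒ.j-onto (trans ιₒb≡ (sym (Lᵢ.ι∘j a)))
      from : (∃ λ b → Lₒ.j b ≡ Lᵢ.j a) → a ∈ preimage εᵢ T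
      from (b , jb≡ja) = ∈-preimage⁺ (proj₂ (T-def (εᵢ a))
                           (εₒ b , trans (sym (Lₒ.ι∘j b)) (trans (cong ι jb≡ja) (Lᵢ.ι∘j a))))

  gpc-restriction : ∀ {M : SimpleMatroid n} {M₁ : SimpleMatroid n₁} {M₂ : SimpleMatroid n₂}
    (G : IsGPC F M M₁ M₂) {Fl} → IsFlat M Fl →
    ∀ {M′ : SimpleMatroid m} {ι} → IsRestriction M′ M ι Fl →
    ∀ {M′₁ : SimpleMatroid m₁} {ε₁} → IsRestriction M′₁ M₁ ε₁ (preimage (IsGPC.ι₁ G) Fl) →
    ∀ {M′₂ : SimpleMatroid m₂} {ε₂} → IsRestriction M′₂ M₂ ε₂ (preimage (IsGPC.ι₂ G) Fl) →
    IsGPC F M′ M′₁ M′₂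
  gpc-restriction {M₁ = M₁} {M₂} G {Fl} Fl-flat {M′} {ι} R {M′₁} {ε₁} R₁ {M′₂} {ε₂} R₂ = record
    { ι₁         = L₁.j
    ; ι₂         = L₂.j
    ; ι₁-inj     = L₁.j-injective
    ; ι₂-inj     = L₂.j-injective
    ; cover      = cover′
    ; T₁         = preimage ε₁ T₁
    ; T₂         = preimage ε₂ T₂
    ; T₁-def     = Glue.overlap-preimage R ι₁-inj R₁ ι₂-inj R₂ T₁-def
    ; T₂-def     = Glue.overlap-preimage R ι₂-inj R₂ ι₁-inj R₁ T₂-def
    ; T₁-modular = modular-preimage R₁ Fl₁-flat T₁-modular
    ; N-PG       = subst (IsPGRestriction F M′₁) (R₁.preimage-∩ T₁)
                         (isPG-restriction R₁ (p∩q⊆q T₁ _)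
                           (isPG-flat {M = M₁} {X = T₁} N-PG (p∩q⊆p T₁ _) (flat-∩ M₁ (proj₁ T₁-modular) Fl₁-flat)))
    ; agree      = agree′
    ; flats      = flats′
    }
    where
    open IsGPC G
    module R  = IsRestriction R
    module R₁ = IsRestriction R₁
    module L₁ = Lift R ι₁ ι₁-inj R₁
    module L₂ = Lift R ι₂ ι₂-inj R₂

    Fl₁-flat : IsFlat M₁ (preimage ι₁ Fl)
    Fl₁-flat = proj₁ (proj₁ (flats Fl) Fl-flat)

    Fl₂-flat : IsFlat M₂ (preimage ι₂ Fl)
    Fl₂-flat = proj₂ (proj₁ (flats Fl) Fl-flat)

    cover′ : ∀ e → (∃ λ a → L₁.j a ≡ e) ⊎ (∃ λ b → L₂.j b ≡ e)
    cover′ e with cover (ι e)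
    ... | inj₁ (_ , ι₁a≡ιe) = inj₁ (L₁.j-onto ι₁a≡ιe)
    ... | inj₂ (_ , ι₂b≡ιe) = inj₂ (L₂.j-onto ι₂b≡ιe)

    agree′ : ∀ X → (∀ {e} → e ∈ X → (∃ λ a → L₁.j a ≡ e) × (∃ λ b → L₂.j b ≡ e)) →
             r M′₁ (preimage L₁.j X) ≡ r M′₂ (preimage L₂.j X)
    agree′ X in-both = trans (L₁.r-preimage-j X) (trans (agree (image ι X) ιX-in-both) (sym (L₂.r-preimage-j X)))
      where
      ιX-in-both : ∀ {e} → e ∈ image ι X → (∃ λ a → ι₁ a ≡ e) × (∃ λ b → ι₂ b ≡ e)
      ιX-in-both p with ∈-image⁻ ι X p
      ... | e , e∈X , refl with in-both e∈X
      ...   | (a , refl) , (b , j₂b≡j₁a) =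
        (ε₁ a , sym (L₁.ι∘j a)) , (ε₂ b , trans (sym (L₂.ι∘j b)) (cong ι j₂b≡j₁a))

    flats′ : ∀ X → (IsFlat M′ X → IsFlat M′₁ (preimage L₁.j X) × IsFlat M′₂ (preimage L₂.j X))
                 × (IsFlat M′₁ (preimage L₁.j X) × IsFlat M′₂ (preimage L₂.j X) → IsFlat M′ X)
    flats′ X = to , from
      where
      to : IsFlat M′ X → IsFlat M′₁ (preimage L₁.j X) × IsFlat M′₂ (preimage L₂.j X)
      to X-flat with proj₁ (flats (image ι X)) (R.flat-image⁺ Fl-flat X X-flat)
      ... | ιX₁-flat , ιX₂-flat = L₁.flat-preimage-j⁻ X ιX₁-flat , L₂.flat-preimage-j⁻ X ιX₂-flat
      from : IsFlat M′₁ (preimage L₁.j X) × IsFlat M′₂ (preimage L₂.j X) → IsFlat M′ X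
      from (X₁-flat , X₂-flat) = R.flat-image⁻ X (proj₂ (flats (image ι X))
        (L₁.flat-preimage-j⁺ Fl₁-flat X X₁-flat , L₂.flat-preimage-j⁺ Fl₂-flat X X₂-flat))

module _ {q : ℕ} (F : FiniteField q) where

  open ProjectiveGeometry F using (isPG-restriction; isPG-flat)
  open ParallelConnection F using (gpc-restriction)

  inClass-restriction : ∀ {M : SimpleMatroid n} {Fl} → InClass F M → IsFlat M Fl →
                        ∀ {M′ : SimpleMatroid m} {ι} → IsRestriction M′ M ι Fl → InClass F M′
  inClass-restriction {M = M} {Fl} (pg M-PG) Fl-flat {M′} R =
    pg (subst (IsPGRestriction F M′) (IsRestriction.preimage-⊤ R)
              (isPG-restriction R ⊆-refl (isPG-flat {M = M} {X = ⊤} M-PG ⊆⊤ Fl-flat)))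
  inClass-restriction {Fl = Fl} (gpc {M₁ = M₁} {M₂} M₁∈ M₂∈ G) Fl-flat R
    with restriction M₁ (preimage (IsGPC.ι₁ G) Fl) | restriction M₂ (preimage (IsGPC.ι₂ G) Fl)
  ... | _ , _ , _ , R₁ | _ , _ , _ , R₂ =
    gpc (inClass-restriction M₁∈ (proj₁ Fl-flats) R₁) (inClass-restriction M₂∈ (proj₂ Fl-flats) R₂)
        (gpc-restriction G Fl-flat R R₁ R₂)
    where
    Fl-flats : IsFlat M₁ (preimage (IsGPC.ι₁ G) Fl) × IsFlat M₂ (preimage (IsGPC.ι₂ G) Fl)
    Fl-flats = proj₁ (IsGPC.flats G Fl) Fl-flat

lemma2p2 : ∀ {q} (F : FiniteField q) {n} (M : SimpleMatroid n) (Fl : Subset n) →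
    InClass F M → IsFlat M Fl →
    ∀ {m} (M' : SimpleMatroid m) (ι : Fin m → Fin n) → Injective _≡_ _≡_ ι →
    (∀ e → (e ∈ Fl → ∃ λ a → ι a ≡ e) × ((∃ λ a → ι a ≡ e) → e ∈ Fl)) →
    (∀ Y → Y ⊆ Fl → r M' (preimage ι Y) ≡ r M Y) →
    InClass F M'
lemma2p2 F M Fl M∈ Fl-flat M′ ι ι-injective ι-image ι-rank = inClass-restriction F M∈ Fl-flat R
  where
  R : IsRestriction M′ M ι Fl
  R = record
    { enumeration = record
      { injective = ι-injective
      ; onto      = λ {e} → proj₁ (ι-image e)
      ; into      = λ a → proj₂ (ι-image (ι a)) (a , refl)
      }
    ; rank        = ι-rank
    }
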